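{- Let $R$ be a binary predicate symbol and let $\varphi(x):=\bar\exists y\,R(x,y)$. Then the formula $$\big(\forall x((\varphi(x) \to \forall x\,\varphi(x)) \to \forall x\,\varphi(x))\big) \to \forall x\,\varphi(x)$$ does not belong to $\mathsf{InqBQ}$.
   Context: Language: a countably infinite set $\mathsf{Var}$ of individual variables and a countably infinite set $\mathsf{Pred}$ of predicate symbols, each with a fixed arity $m\ge 0$ (no identity, constants or function symbols). Formulas: $\varphi ::= P(x_1,\dots,x_m)\mid \bot\mid \varphi\to\varphi\mid\varphi\wedge\varphi\mid \varphi\veebar\varphi\mid \forall x\varphi\mid \bar\exists x\varphi$, where $\veebar$ is inquisitive disjunction and $\bar\exists$ the inquisitive existential quantifier. A relational information model is $\mathfrak M=(W,D,\mathfrak I)$ with $W$ a nonempty set of worlds, $D$ a nonempty set of individuals, and $\mathfrak I(P,w)\subseteq D^m$ for each $m$-ary $P$ and $w\in W$. A state is any $s\subseteq W$. For $g:\mathsf{Var}\to D$: $\mathfrak M,s\Vdash_g P(x_1,\dots,x_m)$ iff $(g(x_1),\dots,g(x_m))\in\mathfrak I(P,w)$ for all $w\in s$; $\mathfrak M,s\Vdash_g\bot$ iff $s=\varnothing$; $\wedge$ pointwise; $\mathfrak M,s\Vdash_g\varphi\to\psi$ iff for all $t\subseteq s$, $\mathfrak M,t\Vdash_g\varphi$ implies $\mathfrak M,t\Vdash_g\psi$; $\mathfrak M,s\Vdash_g\varphi\veebar\psi$ iff $\mathfrak M,s\Vdash_g\varphi$ or $\mathfrak M,s\Vdash_g\psi$;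 $\mathfrak M,s\Vdash_g\forall x\varphi$ iff $\mathfrak M,s\Vdash_{g[x\mapsto d]}\varphi$ for all $d\in D$; $\mathfrak M,s\Vdash_g\bar\exists x\varphi$ iff $\mathfrak M,s\Vdash_{g[x\mapsto d]}\varphi$ for some $d\in D$. $\mathsf{InqBQ}$ is the set of formulas supported at every state under every assignment in every relational information model. -}

module Defs where

open import Data.Nat using (ℕ; _≟_)
open import Data.Vec using (Vec; map)
open import Data.Empty using (⊥)
open import Data.Product using (Σ; _×_)
open import Relation.Nullary using (¬_; yes; no)
open import Level using (Lift)
open import Data.Sum using (_⊎_)

Var : Set
Var = ℕ

record PredSym : Set where
  constructor pred
  field
    name  : ℕ
    arity : ℕ
open PredSym public

-- Formulas of InqBQ (no identity, constants, function symbols).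
data Form : Set where
  atom  : (P : PredSym) → Vec Var (arity P) → Form
  ⊥'    : Form
  _⇒_   : Form → Form → Form
  _∧'_  : Form → Form → Form
  _⩒_   : Form → Form → Form
  ∀'    : Var → Form → Form
  ∃̄     : Var → Form → Form

-- Relational information models (W, D nonempty).
record Model : Set₁ where
  field
    W  : Set
    D  : Set
    w₀ : W
    d₀ : D
    I  : (P : PredSym) → W → Vec D (arity P) → Set
open Model public

State : Model → Set₁
State M = W M → Set

_⊆_ : {A : Set} → (A → Set) → (A → Set) → Set
t ⊆ s = ∀ w → t w → s w

_[_↦_] : {D : Set} → (Var → D) → Var → D → (Var → D)
(g [ x ↦ d ]) z with z ≟ x
... | yes _ = d
... | no  _ = g z

Supp : (M : Model) → State M → (Var → D M) → Form → Set₁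
Supp M s g (atom P xs) = Lift _ (∀ w → s w → I M P w (map g xs))
Supp M s g ⊥'          = Lift _ (∀ w → ¬ s w)
Supp M s g (φ ⇒ ψ)     = (t : State M) → t ⊆ s → Supp M t g φ → Supp M t g ψ
Supp M s g (φ ∧' ψ)    = Supp M s g φ × Supp M s g ψ
Supp M s g (φ ⩒ ψ)     = Supp M s g φ ⊎ Supp M s g ψ
Supp M s g (∀' x φ)    = (d : D M) → Supp M s (g [ x ↦ d ]) φ
Supp M s g (∃̄ x φ)     = Σ (D M) (λ d → Supp M s (g [ x ↦ d ]) φ)

InqBQ : Form → Set₁
InqBQ φ = (M : Model) (s : State M) (g : Var → D M) → Supp M s g φ

open import Data.Vec using ([]; _∷_)

φR : ℕ → Var → Var → Form
φR r x y = ∃̄ y (atom (pred r 2) (x ∷ y ∷ []))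

thm3Formula : ℕ → Var → Var → Form
thm3Formula r x y =
  (∀' x ((φR r x y ⇒ ∀' x (φR r x y)) ⇒ ∀' x (φR r x y))) ⇒ ∀' x (φR r x y)

{-# OPTIONS --safe #-}

-- Take binary words as both worlds and individuals, and let R(a, b) hold at w
-- iff a ++ b is not a prefix of w. Then φ(a) is supported at a state s iff s
-- misses the cone above some extension of a, so ∀x φ(x) is supported at s iff
-- s is nowhere dense in the binary tree; in particular it fails at the state of
-- all worlds. The antecedent, however, is supported everywhere: if t supports
-- φ(d) → ∀x φ(x), apply this to the two substates of t missing the cones above
-- d0 and d1. Both support φ(d), hence are nowhere dense, and they cover t;
-- nowhere dense sets are closed under finite unions.
module Submission where

open import Defs
open import Data.Bool using (Bool; true; false)
open import Data.Bool.Properties using () renaming (_≟_ to _≟ᵇ_)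
open import Data.Empty using (⊥-elim)
open import Data.List using (List; []; _∷_; _++_; _∷ʳ_; [_])
open import Data.List.Properties using (++-assoc)
open import Data.List.Relation.Binary.Pointwise as Pointwise using ()
open import Data.List.Relation.Binary.Prefix.Heterogeneous using (Prefix; []; _∷_)
open import Data.List.Relation.Binary.Prefix.Heterogeneous.Properties using (fromPointwise; prefix?)
open import Data.Nat using (ℕ; _≟_)
open import Data.Product using (_,_; proj₁; proj₂; ∃-syntax)
open import Data.Sum as Sum using (inj₁; inj₂)
open import Data.Unit using (⊤; tt)
open import Data.Vec using (Vec; []; _∷_)
open import Function using (case_of_)
open import Function.Bundles using (_⇔_; mk⇔; module Equivalence)
open import Level using (0ℓ; lift)
open import Relation.Binary.PropositionalEquality using (_≡_; _≢_; refl; sym; trans; subst; cong₂)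
open import Relation.Nullary using (¬_; yes; no)
open import Relation.Unary using (Pred; U; ∁; _∪_; _∩_)

update-≡ : ∀ {D : Set} (g : Var → D) x d → (g [ x ↦ d ]) x ≡ d
update-≡ g x d with x ≟ x
... | yes _  = refl
... | no x≢x = ⊥-elim (x≢x refl)

update-≢ : ∀ {D : Set} (g : Var → D) {x z} d → z ≢ x → (g [ x ↦ d ]) z ≡ g z
update-≢ g {x} {z} d z≢x with z ≟ x
... | yes z≡x = ⊥-elim (z≢x z≡x)
... | no _    = refl

module _ {A : Set} where

  infix 4 _≼_

  _≼_ : List A → List A → Set
  _≼_ = Prefix _≡_

  ≼-refl : ∀ {u} → u ≼ u
  ≼-refl = fromPointwise (Pointwise.refl refl)

  ++-≼⁻ : ∀ u v {w} → u ++ v ≼ w → u ≼ w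
  ++-≼⁻ []      v p       = []
  ++-≼⁻ (_ ∷ u) v (q ∷ p) = q ∷ ++-≼⁻ u v p

  ∷ʳ-≼-injective : ∀ u {a b w} → u ∷ʳ a ≼ w → u ∷ʳ b ≼ w → a ≡ b
  ∷ʳ-≼-injective []      (p ∷ _) (q ∷ _) = trans p (sym q)
  ∷ʳ-≼-injective (_ ∷ u) (_ ∷ p) (_ ∷ q) = ∷ʳ-≼-injective u p q

Word : Set
Word = List Bool

Cone : Word → Pred Word 0ℓ
Cone u = u ≼_

MissesCone : Pred Word 0ℓ → Word → Set
MissesCone s u = s ⊆ ∁ (Cone u)

MissesConeAbove : Pred Word 0ℓ → Word → Set
MissesConeAbove s d = ∃[ e ] MissesCone s (d ++ e)

NowhereDense : Pred Word 0ℓ → Set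
NowhereDense s = ∀ d → MissesConeAbove s d

missesCone-++ : ∀ {s} u v → MissesCone s u → MissesCone s (u ++ v)
missesCone-++ u v s⊆ w sw p = s⊆ w sw (++-≼⁻ u v p)

nowhereDense-⊆ : ∀ {s t} → t ⊆ s → NowhereDense s → NowhereDense t
nowhereDense-⊆ t⊆s nd d with e , s⊆ ← nd d = e , λ w tw → s⊆ w (t⊆s w tw)

nowhereDense-∪ : ∀ {u v} → NowhereDense u → NowhereDense v → NowhereDense (u ∪ v)
nowhereDense-∪ {u} {v} ndu ndv d
  with e₁ , u⊆ ← ndu d
  with e₂ , v⊆ ← ndv (d ++ e₁)
  = e₁ ++ e₂ , subst (MissesCone (u ∪ v)) (++-assoc d e₁ e₂)
                 (λ w → Sum.[ missesCone-++ (d ++ e₁) e₂ u⊆ w , v⊆ w ])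

¬nowhereDense-U : ¬ NowhereDense U
¬nowhereDense-U nd with e , U⊆ ← nd [] = U⊆ e tt ≼-refl

U⊆∁-Cone-∷ʳ-false∪true : ∀ d → U ⊆ (∁ (Cone (d ∷ʳ false)) ∪ ∁ (Cone (d ∷ʳ true)))
U⊆∁-Cone-∷ʳ-false∪true d w _ with prefix? _≟ᵇ_ (d ∷ʳ false) w
... | no  ¬p₀ = inj₁ ¬p₀
... | yes p₀  = inj₂ λ p₁ → case ∷ʳ-≼-injective d p₀ p₁ of λ ()

notPrefix : (n : ℕ) → Word → Vec Word n → Set
notPrefix 2 w (a ∷ b ∷ []) = ¬ a ++ b ≼ w
notPrefix _ _ _            = ⊤

prefixModel : Model
prefixModel = record
  { W = Word ; D = Word ; w₀ = [] ; d₀ = [] ; I = λ P → notPrefix (arity P) }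

module _ (r : ℕ) {x y : Var} (x≢y : x ≢ y) where

  private
    M : Model
    M = prefixModel

    φ : Form
    φ = φR r x y

  R-atom-word : ∀ (g : Var → Word) e → (g [ y ↦ e ]) x ++ (g [ y ↦ e ]) y ≡ g x ++ e
  R-atom-word g e = cong₂ _++_ (update-≢ g e x≢y) (update-≡ g y e)

  φ-supported⇔ : ∀ s g → Supp M s g φ ⇔ MissesConeAbove s (g x)
  φ-supported⇔ s g = mk⇔
    (λ (e , lift s⊆) → e , subst (MissesCone s) (R-atom-word g e) s⊆)
    (λ (e , s⊆) → e , lift (subst (MissesCone s) (sym (R-atom-word g e)) s⊆))

  ∀φ-supported⇔ : ∀ s g → Supp M s g (∀' x φ) ⇔ NowhereDense s
  ∀φ-supported⇔ s g = mk⇔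
    (λ S d → subst (MissesConeAbove s) (update-≡ g x d)
               (Equivalence.to (φ-supported⇔ s (g [ x ↦ d ])) (S d)))
    (λ nd d → Equivalence.from (φ-supported⇔ s (g [ x ↦ d ]))
                (subst (MissesConeAbove s) (sym (update-≡ g x d)) (nd d)))

  antecedent-supported : ∀ s g → Supp M s g (∀' x ((φ ⇒ ∀' x φ) ⇒ ∀' x φ))
  antecedent-supported s g d t _ t⊩φ⇒∀φ =
    Equivalence.from (∀φ-supported⇔ t h)
      (nowhereDense-⊆ t⊆branches
        (nowhereDense-∪ (branch-nowhereDense false) (branch-nowhereDense true)))
    where
    h : Var → Word
    h = g [ x ↦ d ]

    branch : Bool → Pred Word 0ℓ
    branch b = t ∩ ∁ (Cone (d ∷ʳ b))

    branch⊩φ : ∀ b → Supp M (branch b) h φ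
    branch⊩φ b = Equivalence.from (φ-supported⇔ (branch b) h)
      (subst (MissesConeAbove (branch b)) (sym (update-≡ g x d)) ([ b ] , λ _ → proj₂))

    branch-nowhereDense : ∀ b → NowhereDense (branch b)
    branch-nowhereDense b = Equivalence.to (∀φ-supported⇔ (branch b) h)
      (t⊩φ⇒∀φ (branch b) (λ _ → proj₁) (branch⊩φ b))

    t⊆branches : t ⊆ (branch false ∪ branch true)
    t⊆branches w tw = Sum.map (tw ,_) (tw ,_) (U⊆∁-Cone-∷ʳ-false∪true d w tt)

theorem3 : (r : ℕ) (x y : Var) → x ≢ y → ¬ InqBQ (thm3Formula r x y)
theorem3 r x y x≢y inq =
  ¬nowhereDense-U (Equivalence.to (∀φ-supported⇔ r x≢y U g)
    (inq prefixModel U g U (λ _ u → u) (antecedent-supported r x≢y U g)))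
  where
  g : Var → Word
  g _ = []
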